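{- For every integer $n \geq 3$ with $n \neq 4$, $M'_D(K_n) \leq 3$; moreover $M'_D(K_4) = 5$.
   Context: $K_n$ is the complete graph on $n$ vertices. A majority edge coloring is an edge coloring such that for every vertex $u$ and every color $\alpha$, at most half of the edges incident with $u$ have color $\alpha$. It is distinguishing if the only automorphism $\varphi$ of the graph with $c(\varphi(u)\varphi(v))=c(uv)$ for all edges $uv$ is the identity. $M'_D(G)$ is the least number of colors in an edge coloring of $G$ that is both majority and distinguishing. -}

module Defs where

open import Data.Nat using (ℕ; _*_; _∸_; _≤_; _<_)
open import Data.Fin using (Fin; _≟_)
open import Data.Fin.Permutation using (Permutation′; _⟨$⟩ʳ_)
open import Data.List using (List; length; filter)
open import Data.List.Base using (allFin)
open import Data.Product using (_×_; Σ; ∃)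
open import Relation.Binary.PropositionalEquality using (_≡_; _≢_)
open import Relation.Nullary using (¬_; Dec; yes; no)
open import Relation.Nullary.Decidable using (_×-dec_; ¬?)

-- An edge colouring of the complete graph K_n (vertex set Fin n) with at most
-- k colours (colour set Fin k): a function on ordered pairs of vertices that is
-- symmetric on edges (u ≢ v).  Values on the diagonal are irrelevant (never used).
record EdgeColouring (n k : ℕ) : Set where
  field
    col : Fin n → Fin n → Fin k
    sym : ∀ u v → u ≢ v → col u v ≡ col v u
open EdgeColouring public

degCol : ∀ {n k} → EdgeColouring n k → Fin n → Fin k → ℕ
degCol {n} c u α =
  length (filter (λ v → ¬? (u ≟ v) ×-dec (col c u v ≟ α)) (allFin n))

IsMajority : ∀ {n k} → EdgeColouring n k → Set
IsMajority {n} c = ∀ u α → 2 * degCol c u α ≤ n ∸ 1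

-- automorphisms of K_n are exactly the permutations of the vertex set;
-- distinguishing: only the identity preserves all edge colours
IsDistinguishing : ∀ {n k} → EdgeColouring n k → Set
IsDistinguishing {n} c =
  ∀ (φ : Permutation′ n) →
    (∀ u v → u ≢ v → col c (φ ⟨$⟩ʳ u) (φ ⟨$⟩ʳ v) ≡ col c u v) →
    ∀ u → φ ⟨$⟩ʳ u ≡ u

HasMDColouring : ℕ → ℕ → Set
HasMDColouring n k = Σ (EdgeColouring n k) λ c → IsMajority c × IsDistinguishing c

M'D≤ : ℕ → ℕ → Set
M'D≤ n k = HasMDColouring n k

M'D≡ : ℕ → ℕ → Set
M'D≡ n k = HasMDColouring n k × (∀ j → j < k → ¬ HasMDColouring n j)

-- For n ≥ 5, give the Hamiltonian path 0 — 1 — ⋯ — (n−1) colour 2 and every other edge {a, b}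
-- the parity of a + b, flipped when one endpoint lies in {0, 1} and the other in {2, 3}.  Seen
-- from a vertex u, the two vertices of a pair {2j, 2j+1} not containing u get different colours
-- (their parities differ, the flip does not), while the pair containing u consists of u and a
-- path neighbour; so colours 0 and 1 occur at most ⌈n/2⌉ − 1 times at u, and colour 2 at most
-- twice.  A colour-preserving permutation preserves the path, so it is the identity or the
-- reversal i ↦ n−1−i, which keeps the parity of a + b but moves the flipped edge {0, 2} to the
-- unflipped edge {n−1, n−3}.  On K₃ and K₄ explicit colourings are verified by evaluation.
-- On K₄ a majority colouring is proper.  If two of the three perfect matchings are
-- monochromatic, the involution 0 ↔ 3, 1 ↔ 2 preserves the colours; otherwise two matchings
-- carry two colours each, and an edge of the third matching meets all four of their edges,
-- which makes five colours.

module Submission where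

open import Defs renaming (sym to col-sym)

open import Algebra.Properties.CommutativeSemigroup using (interchange)
open import Data.Empty using (⊥-elim)
import Data.Fin as Fin
open Fin using (Fin; toℕ)
open import Data.Fin.Patterns using (0F; 1F; 2F; 3F; 4F)
open import Data.Fin.Permutation
  using (Permutation′; _⟨$⟩ʳ_; _⟨$⟩ˡ_; inverseˡ; inverseʳ; flip; _∘ₚ_; reverse; transpose)
open import Data.Fin.Properties using (toℕ-injective; toℕ<n; toℕ-fromℕ<; all?; injective⇒≤)
open import Data.List as List using (List; []; _∷_; length; filter; tabulate)
open import Data.List.Membership.Propositional using (_∈_)
open import Data.List.Membership.Propositional.Properties using (∈-length; ∈-filter⁺; ∈-allFin; ∈-lookup)
import Data.List.Relation.Unary.All as All
open All using ([]; _∷_)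
open import Data.List.Relation.Unary.AllPairs using (AllPairs; []; _∷_)
open import Data.List.Relation.Unary.Any using (here; there)
open import Data.Nat using (NonZero; ℕ; zero; suc; _+_; _*_; _∸_; _≤_; _<_; z≤n; s≤s; s≤s⁻¹; _≤?_; ⌊_/2⌋; ⌈_/2⌉; parity)
open import Data.Nat.DivMod using (_mod_; m<n⇒m%n≡m)
open import Data.Nat.Properties
  using (_≟_; ≤-refl; ≤-trans; ≤-reflexive; ≤-antisym; <-irrefl; <⇒≱; n≤1+n; m≤n+m; m≤m+n; m≤n⇒m≤1+n;
         n≤0⇒n≡0; suc-injective; m+1+n≢n; +-assoc; +-comm; +-suc; +-identityʳ; +-cancelʳ-≡; +-cancelʳ-≤;
         +-mono-≤; +-monoˡ-≤; *-monoʳ-≤; *-suc; ∸-monoˡ-≤; +-commutativeSemigroup)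
open import Data.Parity.Base as ℙ using (Parity; 0ℙ; 1ℙ; _⁻¹)
import Data.Parity.Properties as ℙₚ
open import Data.Product using (_×_; _,_)
open import Data.Sum using (_⊎_; inj₁; inj₂; [_,_]′; swap) renaming (map to ⊎-map)
open import Data.Vec using (Vec; []; _∷_; lookup)
import Data.Vec as Vec
open import Data.Vec.Properties using (lookup∘tabulate)
open import Function using (_∘_)
open import Level using (0ℓ)
open import Relation.Binary.PropositionalEquality using (_≡_; _≢_; refl; sym; trans; cong; cong₂; module ≡-Reasoning)
open import Relation.Nullary using (¬_; Dec; yes; no)
open import Relation.Nullary.Decidable using (_⊎-dec_; _×-dec_; _→-dec_; ¬?; map′; from-yes)
open import Relation.Unary using (Pred; Decidable)

variable
  A : Set
  Q R S : Pred ℕ 0ℓ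

indicator : Dec A → ℕ
indicator (yes _) = 1
indicator (no  _) = 0

count : Decidable Q → ℕ → ℕ
count Q? zero    = 0
count Q? (suc n) = indicator (Q? 0) + count (Q? ∘ suc) n

count-none : (Q? : Decidable Q) → (∀ v → ¬ Q v) → ∀ n → count Q? n ≡ 0
count-none Q? none zero = refl
count-none Q? none (suc n) with Q? 0
... | yes q = ⊥-elim (none 0 q)
... | no  _ = count-none (Q? ∘ suc) (none ∘ suc) n

count-unique : (Q? : Decidable Q) → (∀ {v w} → Q v → Q w → v ≡ w) → ∀ n → count Q? n ≤ 1
count-unique Q? unique zero = z≤n
count-unique Q? unique (suc n) with Q? 0
... | yes q = s≤s (≤-reflexive (count-none (Q? ∘ suc) (λ _ q′ → zero≢suc (unique q q′)) n))
  where zero≢suc : ∀ {v} → 0 ≢ suc v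
        zero≢suc ()
... | no  _ = count-unique (Q? ∘ suc) (λ q q′ → suc-injective (unique q q′)) n

count-⊆-⊎ : (Q? : Decidable Q) (R? : Decidable R) (S? : Decidable S) →
            (∀ {v} → Q v → R v ⊎ S v) → ∀ n → count Q? n ≤ count R? n + count S? n
count-⊆-⊎ Q? R? S? ⊆ zero    = z≤n
count-⊆-⊎ Q? R? S? ⊆ (suc n) =
  ≤-trans (+-mono-≤ (indicator-⊎ (Q? 0) (R? 0) (S? 0) ⊆) (count-⊆-⊎ (Q? ∘ suc) (R? ∘ suc) (S? ∘ suc) ⊆ n))
          (≤-reflexive (interchange +-commutativeSemigroup (indicator (R? 0)) (indicator (S? 0)) _ _))
  where
  indicator-⊎ : ∀ {A B C : Set} (a? : Dec A) (b? : Dec B) (c? : Dec C) →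
                (A → B ⊎ C) → indicator a? ≤ indicator b? + indicator c?
  indicator-⊎ (no _)  _       _       _ = z≤n
  indicator-⊎ (yes _) (yes _) _       _ = s≤s z≤n
  indicator-⊎ (yes _) (no _)  (yes _) _ = s≤s z≤n
  indicator-⊎ (yes a) (no ¬b) (no ¬c) f with f a
  ... | inj₁ b = ⊥-elim (¬b b)
  ... | inj₂ c = ⊥-elim (¬c c)

-- ⌊ v /2⌋ ≡ ⌊ suc v /2⌋ holds exactly for even v: Q holds at most once on each pair {2j, 2j + 1}.
PairFree : Pred ℕ 0ℓ → Set
PairFree Q = ∀ v → ⌊ v /2⌋ ≡ ⌊ suc v /2⌋ → Q v → ¬ Q (suc v)

pairFree-shift : PairFree Q → PairFree (Q ∘ suc ∘ suc)
pairFree-shift pairFree v sameHalf = pairFree (suc (suc v)) (cong suc sameHalf)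

indicator-pair : (Q? : Decidable Q) → PairFree Q → indicator (Q? 0) + indicator (Q? 1) ≤ 1
indicator-pair Q? pairFree with Q? 0 | Q? 1
... | yes q₀ | yes q₁ = ⊥-elim (pairFree 0 refl q₀ q₁)
... | yes _  | no _   = ≤-refl
... | no _   | yes _  = ≤-refl
... | no _   | no _   = z≤n

count-pairFree : (Q? : Decidable Q) → PairFree Q → ∀ n → count Q? n ≤ ⌈ n /2⌉
count-pairFree Q? pairFree zero          = z≤n
count-pairFree Q? pairFree (suc zero)    with Q? 0
... | yes _ = ≤-refl
... | no _  = z≤n
count-pairFree Q? pairFree (suc (suc n)) =
  ≤-trans (≤-reflexive (sym (+-assoc (indicator (Q? 0)) (indicator (Q? 1)) _)))
          (+-mono-≤ (indicator-pair Q? pairFree) (count-pairFree (Q? ∘ suc ∘ suc) (pairFree-shift pairFree) n))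

count-skip-pair : (Q? : Decidable Q) → ¬ Q 0 → ¬ Q 1 → ∀ n →
                  count Q? (suc (suc n)) ≡ count (Q? ∘ suc ∘ suc) n
count-skip-pair Q? ¬q₀ ¬q₁ n with Q? 0 | Q? 1
... | yes q₀ | _      = ⊥-elim (¬q₀ q₀)
... | no _   | yes q₁ = ⊥-elim (¬q₁ q₁)
... | no _   | no _   = refl

count-pairFree-hole : (Q? : Decidable Q) → PairFree Q → ∀ {u} n → u < n →
                      (∀ v → ⌊ v /2⌋ ≡ ⌊ u /2⌋ → ¬ Q v) → suc (count Q? n) ≤ ⌈ n /2⌉
count-pairFree-hole Q? pairFree {zero} (suc zero) _ hole with Q? 0
... | yes q₀ = ⊥-elim (hole 0 refl q₀)
... | no _   = ≤-refl
count-pairFree-hole Q? pairFree {suc _} (suc zero) (s≤s ()) hole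
count-pairFree-hole Q? pairFree {zero} (suc (suc n)) _ hole
  rewrite count-skip-pair Q? (hole 0 refl) (hole 1 refl) n =
  s≤s (count-pairFree (Q? ∘ suc ∘ suc) (pairFree-shift pairFree) n)
count-pairFree-hole Q? pairFree {suc zero} (suc (suc n)) _ hole
  rewrite count-skip-pair Q? (hole 0 refl) (hole 1 refl) n =
  s≤s (count-pairFree (Q? ∘ suc ∘ suc) (pairFree-shift pairFree) n)
count-pairFree-hole Q? pairFree {suc (suc u)} (suc (suc n)) (s≤s (s≤s u<n)) hole =
  s≤s (≤-trans (≤-reflexive (sym (+-assoc (indicator (Q? 0)) (indicator (Q? 1)) _)))
       (≤-trans (+-monoˡ-≤ _ (indicator-pair Q? pairFree))
                (count-pairFree-hole (Q? ∘ suc ∘ suc) (pairFree-shift pairFree) n u<n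
                                     (λ v sameHalf → hole (suc (suc v)) (cong suc sameHalf)))))

2*⌊n/2⌋≤n : ∀ m → 2 * ⌊ m /2⌋ ≤ m
2*⌊n/2⌋≤n zero          = z≤n
2*⌊n/2⌋≤n (suc zero)    = z≤n
2*⌊n/2⌋≤n (suc (suc m)) = ≤-trans (≤-reflexive (*-suc 2 ⌊ m /2⌋)) (s≤s (s≤s (2*⌊n/2⌋≤n m)))

c<⌈[1+m]/2⌉⇒2*c≤m : ∀ {c m} → suc c ≤ ⌈ suc m /2⌉ → 2 * c ≤ m
c<⌈[1+m]/2⌉⇒2*c≤m {c} {m} c<half =
  s≤s⁻¹ (s≤s⁻¹ (≤-trans (≤-reflexive (sym (*-suc 2 c)))
                        (≤-trans (*-monoʳ-≤ 2 c<half) (2*⌊n/2⌋≤n (suc (suc m))))))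

Adjacent : ℕ → ℕ → Set
Adjacent a b = suc a ≡ b ⊎ suc b ≡ a

adjacent? : ∀ a b → Dec (Adjacent a b)
adjacent? a b = (suc a ≟ b) ⊎-dec (suc b ≟ a)

parity-suc : ∀ n → parity (suc n) ≡ parity n ⁻¹
parity-suc n = sym (ℙₚ.⁻¹-selfInverse (ℙₚ.suc-homo-⁻¹ n))

adjacent⇒opposite-parity : ∀ {a b} → Adjacent a b → parity b ≡ parity a ⁻¹
adjacent⇒opposite-parity {a} (inj₁ refl) = parity-suc a
adjacent⇒opposite-parity {b = b} (inj₂ refl) = sym (ℙₚ.suc-homo-⁻¹ b)

¬adjacent-consecutive : ∀ {u v} → Adjacent u v → ¬ Adjacent u (suc v)
¬adjacent-consecutive {u} {v} u~v u~sv = ℙₚ.p≢p⁻¹ (parity v) (sym (begin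
  parity v ⁻¹     ≡⟨ parity-suc v ⟨
  parity (suc v)  ≡⟨ adjacent⇒opposite-parity u~sv ⟩
  parity u ⁻¹     ≡⟨ adjacent⇒opposite-parity u~v ⟨
  parity v        ∎))
  where open ≡-Reasoning

same-half⇒adjacent : ∀ {a b} → a ≢ b → ⌊ a /2⌋ ≡ ⌊ b /2⌋ → Adjacent a b
same-half⇒adjacent {0}           {0}           a≢b _ = ⊥-elim (a≢b refl)
same-half⇒adjacent {0}           {1}           _   _ = inj₁ refl
same-half⇒adjacent {1}           {0}           _   _ = inj₂ refl
same-half⇒adjacent {1}           {1}           a≢b _ = ⊥-elim (a≢b refl)
same-half⇒adjacent {suc (suc a)} {suc (suc b)} a≢b e =
  ⊎-map (cong (suc ∘ suc)) (cong (suc ∘ suc)) (same-half⇒adjacent (a≢b ∘ cong (suc ∘ suc)) (suc-injective e))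

module PathAutomorphism {m : ℕ} (F : ℕ → ℕ)
  (step      : ∀ {i} → suc i ≤ m → Adjacent (F i) (F (suc i)))
  (injective : ∀ {i j} → i ≤ m → j ≤ m → F i ≡ F j → i ≡ j)
  (bounded   : ∀ {i} → i ≤ m → F i ≤ m)
  where

  private
    below : ∀ {i} → suc i ≤ m → i ≤ m
    below = ≤-trans (n≤1+n _)

  walk-up : ∀ {i} → suc (suc i) ≤ m → F (suc i) ≡ suc (F i) → F (suc (suc i)) ≡ suc (F (suc i))
  walk-up {i} i+2≤m up with step i+2≤m
  ... | inj₁ forward = sym forward
  ... | inj₂ back    = ⊥-elim (m+1+n≢n 1 (injective i+2≤m (below (below i+2≤m))
                                                 (suc-injective (trans back up))))

  walk-down : ∀ {i} → suc (suc i) ≤ m → F i ≡ suc (F (suc i)) → F (suc i) ≡ suc (F (suc (suc i)))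
  walk-down {i} i+2≤m down with step i+2≤m
  ... | inj₂ forward = sym forward
  ... | inj₁ back    = ⊥-elim (m+1+n≢n 1 (injective i+2≤m (below (below i+2≤m))
                                                 (sym (trans down back))))

  ascending : F 1 ≡ suc (F 0) → ∀ {i} → i ≤ m → F i ≡ F 0 + i
  ascending up {zero}  _     = sym (+-identityʳ (F 0))
  ascending up {suc i} i+1≤m = begin
    F (suc i)      ≡⟨ steps i+1≤m ⟩
    suc (F i)      ≡⟨ cong suc (ascending up (below i+1≤m)) ⟩
    suc (F 0 + i)  ≡⟨ sym (+-suc (F 0) i) ⟩
    F 0 + suc i    ∎
    where
    open ≡-Reasoning
    steps : ∀ {j} → suc j ≤ m → F (suc j) ≡ suc (F j)
    steps {zero}  _     = up
    steps {suc j} j+2≤m = walk-up j+2≤m (steps (below j+2≤m))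

  descending : F 0 ≡ suc (F 1) → ∀ {i} → i ≤ m → F i + i ≡ F 0
  descending down {zero}  _     = +-identityʳ (F 0)
  descending down {suc i} i+1≤m = begin
    F (suc i) + suc i    ≡⟨ +-suc (F (suc i)) i ⟩
    suc (F (suc i)) + i  ≡⟨ cong (_+ i) (sym (steps i+1≤m)) ⟩
    F i + i              ≡⟨ descending down (below i+1≤m) ⟩
    F 0                  ∎
    where
    open ≡-Reasoning
    steps : ∀ {j} → suc j ≤ m → F j ≡ suc (F (suc j))
    steps {zero}  _     = down
    steps {suc j} j+2≤m = walk-down j+2≤m (steps (below j+2≤m))

  identity-or-reversal : 1 ≤ m → (∀ {i} → i ≤ m → F i ≡ i) ⊎ (∀ {i} → i ≤ m → F i + i ≡ m)
  identity-or-reversal 1≤m with step 1≤m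
  ... | inj₁ up   = inj₁ λ {i} i≤m → trans (ascending (sym up) i≤m) (cong (_+ i) F0≡0)
    where
    F0≡0 : F 0 ≡ 0
    F0≡0 = n≤0⇒n≡0 (+-cancelʳ-≤ m (F 0) 0 (≤-trans (≤-reflexive (sym (ascending (sym up) ≤-refl))) (bounded ≤-refl)))
  ... | inj₂ down = inj₂ λ i≤m → trans (descending (sym down) i≤m) F0≡m
    where
    F0≡m : F 0 ≡ m
    F0≡m = ≤-antisym (bounded z≤n) (≤-trans (m≤n+m m (F m)) (≤-reflexive (descending (sym down) ≤-refl)))

-- Applied to ⌊ a /2⌋ + ⌊ b /2⌋, the bridge is 1ℙ exactly when one of a, b lies in {0, 1} and the
-- other in {2, 3}.
bridge : ℕ → Parity
bridge 1 = 1ℙ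
bridge _ = 0ℙ

fromParity : Parity → Fin 3
fromParity 0ℙ = 0F
fromParity 1ℙ = 1F

offPathColour : ℕ → ℕ → Fin 3
offPathColour a b = fromParity (parity (a + b) ℙ.+ bridge (⌊ a /2⌋ + ⌊ b /2⌋))

colour : ℕ → ℕ → Fin 3
colour a b with adjacent? a b
... | yes _ = 2F
... | no _  = offPathColour a b

fromParity≢2F : ∀ p → fromParity p ≢ 2F
fromParity≢2F 0ℙ ()
fromParity≢2F 1ℙ ()

fromParity-injective : ∀ {p q} → fromParity p ≡ fromParity q → p ≡ q
fromParity-injective {0ℙ} {0ℙ} _ = refl
fromParity-injective {1ℙ} {1ℙ} _ = refl

colour-adjacent : ∀ {a b} → Adjacent a b → colour a b ≡ 2F
colour-adjacent {a} {b} a~b with adjacent? a b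
... | yes _    = refl
... | no  a≁b  = ⊥-elim (a≁b a~b)

colour-nonadjacent : ∀ {a b} → ¬ Adjacent a b → colour a b ≡ offPathColour a b
colour-nonadjacent {a} {b} a≁b with adjacent? a b
... | yes a~b = ⊥-elim (a≁b a~b)
... | no  _   = refl

colour≡2F⇒adjacent : ∀ a b → colour a b ≡ 2F → Adjacent a b
colour≡2F⇒adjacent a b c≡2 with adjacent? a b
... | yes a~b = a~b
... | no  _   = ⊥-elim (fromParity≢2F _ c≡2)

colour-sym : ∀ a b → colour a b ≡ colour b a
colour-sym a b with adjacent? a b | adjacent? b a
... | yes _   | yes _   = refl
... | yes a~b | no  b≁a = ⊥-elim (b≁a (swap a~b))
... | no  a≁b | yes b~a = ⊥-elim (a≁b (swap b~a))
... | no  _   | no  _   rewrite +-comm a b | +-comm ⌊ a /2⌋ ⌊ b /2⌋ = refl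

offPathColour-separates-pair : ∀ {u v} → ⌊ v /2⌋ ≡ ⌊ suc v /2⌋ → offPathColour u v ≢ offPathColour u (suc v)
offPathColour-separates-pair {u} {v} sameHalf same =
  ℙₚ.p≢p⁻¹ (parity (u + v)) (ℙₚ.+-cancelʳ-≡ (bridge (⌊ u /2⌋ + ⌊ v /2⌋)) _ _ (begin
    parity (u + v) ℙ.+ bridge (⌊ u /2⌋ + ⌊ v /2⌋)          ≡⟨ fromParity-injective same ⟩
    parity (u + suc v) ℙ.+ bridge (⌊ u /2⌋ + ⌊ suc v /2⌋)  ≡⟨ cong₂ ℙ._+_ parity-step (cong (λ h → bridge (⌊ u /2⌋ + h)) (sym sameHalf)) ⟩
    parity (u + v) ⁻¹ ℙ.+ bridge (⌊ u /2⌋ + ⌊ v /2⌋)       ∎))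
  where
  open ≡-Reasoning
  parity-step : parity (u + suc v) ≡ parity (u + v) ⁻¹
  parity-step = trans (cong parity (+-suc u v)) (parity-suc (u + v))

colour-separates-pair : ∀ {u v} → ⌊ v /2⌋ ≡ ⌊ suc v /2⌋ → colour u v ≢ colour u (suc v)
colour-separates-pair {u} {v} sameHalf with adjacent? u v | adjacent? u (suc v)
... | yes u~v | yes u~sv = ⊥-elim (¬adjacent-consecutive u~v u~sv)
... | yes _   | no _     = fromParity≢2F _ ∘ sym
... | no _    | yes _    = fromParity≢2F _
... | no _    | no _     = offPathColour-separates-pair {u} sameHalf

colour[4+t,2+t]≡0F : ∀ t → colour (4 + t) (2 + t) ≡ 0F
colour[4+t,2+t]≡0F t = trans (colour-nonadjacent nonadjacent) (cong (λ p → fromParity (p ℙ.+ 0ℙ)) even)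
  where
  nonadjacent : ¬ Adjacent (4 + t) (2 + t)
  nonadjacent (inj₁ e) = m+1+n≢n 2 (suc-injective (suc-injective e))
  nonadjacent (inj₂ e) = m+1+n≢n 0 (sym (suc-injective (suc-injective (suc-injective e))))
  even : parity (t + suc (suc t)) ≡ 0ℙ
  even = begin
    parity (t + suc (suc t))  ≡⟨ cong parity (trans (+-suc t (suc t)) (cong suc (+-suc t t))) ⟩
    parity (t + t)            ≡⟨ ℙₚ.+-homo-+ t t ⟩
    parity t ℙ.+ parity t     ≡⟨ ℙₚ.p+p≡0ℙ (parity t) ⟩
    0ℙ                        ∎
    where open ≡-Reasoning

length-filter-tabulate : ∀ {A : Set} {P : Pred A 0ℓ} (P? : Decidable P) (Q? : Decidable Q) {k} (f : Fin k → A) →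
                         (∀ i → P (f i) → Q (toℕ i)) → (∀ i → Q (toℕ i) → P (f i)) →
                         length (filter P? (tabulate f)) ≡ count Q? k
length-filter-tabulate P? Q? {zero}  f P⇒Q Q⇒P = refl
length-filter-tabulate P? Q? {suc k} f P⇒Q Q⇒P with P? (f Fin.zero) | Q? 0
... | yes _  | yes _  = cong suc (length-filter-tabulate P? (Q? ∘ suc) (f ∘ Fin.suc) (P⇒Q ∘ Fin.suc) (Q⇒P ∘ Fin.suc))
... | no  _  | no  _  = length-filter-tabulate P? (Q? ∘ suc) (f ∘ Fin.suc) (P⇒Q ∘ Fin.suc) (Q⇒P ∘ Fin.suc)
... | yes p  | no ¬q  = ⊥-elim (¬q (P⇒Q Fin.zero p))
... | no ¬p  | yes q  = ⊥-elim (¬p (Q⇒P Fin.zero q))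

permutation-injective : ∀ {n} (φ : Permutation′ n) {x y} → φ ⟨$⟩ʳ x ≡ φ ⟨$⟩ʳ y → x ≡ y
permutation-injective φ {x} {y} e = trans (sym (inverseˡ φ)) (trans (cong (φ ⟨$⟩ˡ_) e) (inverseˡ φ))

Preserves : ∀ {n k} → EdgeColouring n k → (Fin n → Fin n) → Set
Preserves c f = ∀ u v → u ≢ v → col c (f u) (f v) ≡ col c u v

pathColouring : ∀ n → EdgeColouring n 3
pathColouring n = record
  { col = λ u v → colour (toℕ u) (toℕ v)
  ; sym = λ u v _ → colour-sym (toℕ u) (toℕ v)
  }

module _ (u : ℕ) (α : Fin 3) where

  ColouredAt : Pred ℕ 0ℓ
  ColouredAt v = u ≢ v × colour u v ≡ α

  colouredAt? : Decidable ColouredAt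
  colouredAt? v = ¬? (u ≟ v) ×-dec (colour u v Fin.≟ α)

degCol-pathColouring : ∀ n (u : Fin n) α → degCol (pathColouring n) u α ≡ count (colouredAt? (toℕ u) α) n
degCol-pathColouring n u α =
  length-filter-tabulate _ (colouredAt? (toℕ u) α) (λ v → v)
    (λ v (u≢v , c≡α) → (u≢v ∘ toℕ-injective) , c≡α)
    (λ v (u≢v , c≡α) → (u≢v ∘ cong toℕ) , c≡α)

pathColouring-majority : ∀ {m} → 4 ≤ m → IsMajority (pathColouring (suc m))
pathColouring-majority {m} 4≤m u α rewrite degCol-pathColouring (suc m) u α with α Fin.≟ 2F
... | yes refl = ≤-trans (*-monoʳ-≤ 2 path-edges≤2) 4≤m
  where
  path-edges≤2 : count (colouredAt? (toℕ u) 2F) (suc m) ≤ 2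
  path-edges≤2 = ≤-trans
    (count-⊆-⊎ (colouredAt? (toℕ u) 2F) successor? predecessor? (λ (_ , c≡2) → colour≡2F⇒adjacent _ _ c≡2) (suc m))
    (+-mono-≤ (count-unique successor? (λ e e′ → trans (sym e) e′) (suc m))
              (count-unique predecessor? (λ e e′ → suc-injective (trans e (sym e′))) (suc m)))
    where
    successor? : Decidable (λ v → suc (toℕ u) ≡ v)
    successor? v = suc (toℕ u) ≟ v
    predecessor? : Decidable (λ v → suc v ≡ toℕ u)
    predecessor? v = suc v ≟ toℕ u
... | no α≢2 = c<⌈[1+m]/2⌉⇒2*c≤m (count-pairFree-hole (colouredAt? (toℕ u) α) pairFree (suc m) (toℕ<n u) hole)
  where
  pairFree : PairFree (ColouredAt (toℕ u) α)
  pairFree v sameHalf (_ , c≡α) (_ , c′≡α) = colour-separates-pair sameHalf (trans c≡α (sym c′≡α))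
  hole : ∀ v → ⌊ v /2⌋ ≡ ⌊ toℕ u /2⌋ → ¬ ColouredAt (toℕ u) α v
  hole v sameHalf (u≢v , c≡α) =
    α≢2 (trans (sym c≡α) (colour-adjacent (swap (same-half⇒adjacent (u≢v ∘ sym) sameHalf))))

toℕ-mod : ∀ {i n} .{{_ : NonZero n}} → i < n → toℕ (i mod n) ≡ i
toℕ-mod i<n = trans (toℕ-fromℕ< _) (m<n⇒m%n≡m i<n)

pathColouring-distinguishing : ∀ t → IsDistinguishing (pathColouring (5 + t))
pathColouring-distinguishing t φ preserves =
  [ fixed , ⊥-elim ∘ not-reversed ]′ (identity-or-reversal (s≤s z≤n))
  where
  m : ℕ
  m = 4 + t
  F : ℕ → ℕ
  F i = toℕ (φ ⟨$⟩ʳ (i mod suc m))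

  F-preserves : ∀ {i j} → i ≤ m → j ≤ m → i ≢ j → colour (F i) (F j) ≡ colour i j
  F-preserves {i} {j} i≤m j≤m i≢j =
    trans (preserves (i mod suc m) (j mod suc m) (i≢j ∘ λ e → trans (sym i-mod) (trans (cong toℕ e) j-mod)))
          (cong₂ colour i-mod j-mod)
    where
    i-mod : toℕ (i mod suc m) ≡ i
    i-mod = toℕ-mod (s≤s i≤m)
    j-mod : toℕ (j mod suc m) ≡ j
    j-mod = toℕ-mod (s≤s j≤m)

  F-step : ∀ {i} → suc i ≤ m → Adjacent (F i) (F (suc i))
  F-step {i} i<m = colour≡2F⇒adjacent (F i) (F (suc i))
    (trans (F-preserves (≤-trans (n≤1+n i) i<m) i<m (m+1+n≢n 0 ∘ sym)) (colour-adjacent {i} (inj₁ refl)))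

  F-injective : ∀ {i j} → i ≤ m → j ≤ m → F i ≡ F j → i ≡ j
  F-injective i≤m j≤m e =
    trans (sym (toℕ-mod (s≤s i≤m))) (trans (cong toℕ (permutation-injective φ (toℕ-injective e))) (toℕ-mod (s≤s j≤m)))

  open PathAutomorphism F F-step F-injective (λ {i} _ → s≤s⁻¹ (toℕ<n (φ ⟨$⟩ʳ (i mod suc m))))

  fixed : (∀ {i} → i ≤ m → F i ≡ i) → ∀ u → φ ⟨$⟩ʳ u ≡ u
  fixed identity u = toℕ-injective (trans (cong (λ x → toℕ (φ ⟨$⟩ʳ x)) u≡toℕ-u-mod) (identity (s≤s⁻¹ (toℕ<n u))))
    where
    u≡toℕ-u-mod : u ≡ toℕ u mod suc m
    u≡toℕ-u-mod = toℕ-injective (sym (toℕ-mod (toℕ<n u)))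

  not-reversed : ¬ (∀ {i} → i ≤ m → F i + i ≡ m)
  not-reversed reversal = 0F≢1F (begin
    0F                         ≡⟨ colour[4+t,2+t]≡0F t ⟨
    colour (4 + t) (2 + t)     ≡⟨ cong₂ colour F0≡4+t F2≡2+t ⟨
    colour (F 0) (F 2)         ≡⟨ F-preserves z≤n (s≤s (s≤s z≤n)) (λ ()) ⟩
    colour 0 2                 ≡⟨⟩
    1F                         ∎)
    where
    open ≡-Reasoning
    0F≢1F : 0F ≢ 1F
    0F≢1F ()
    F0≡4+t : F 0 ≡ 4 + t
    F0≡4+t = trans (sym (+-identityʳ (F 0))) (reversal z≤n)
    F2≡2+t : F 2 ≡ 2 + t
    F2≡2+t = +-cancelʳ-≡ 2 (F 2) (2 + t) (trans (reversal (s≤s (s≤s z≤n))) (+-comm 2 (2 + t)))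

pathColouring-MD : ∀ t → HasMDColouring (5 + t) 3
pathColouring-MD t = pathColouring (5 + t) , pathColouring-majority (m≤m+n 4 t) , pathColouring-distinguishing t

all-vectors? : ∀ {m} n {P : Pred (Vec (Fin m) n) 0ℓ} → Decidable P → Dec (∀ xs → P xs)
all-vectors? zero    P? = map′ (λ { p [] → p }) (λ f → f []) (P? [])
all-vectors? (suc n) P? = map′ (λ { f (x ∷ xs) → f x xs }) (λ f x xs → f (x ∷ xs))
                               (all? λ x → all-vectors? n λ xs → P? (x ∷ xs))

module _ {n k : ℕ} where

  fromTable : Vec (Vec (Fin k) n) n → Fin n → Fin n → Fin k
  fromTable rows u v = lookup (lookup rows u) v

  Symmetric : (Fin n → Fin n → Fin k) → Set
  Symmetric col = ∀ u v → u ≢ v → col u v ≡ col v u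

  symmetric? : ∀ col → Dec (Symmetric col)
  symmetric? col = all? λ u → all? λ v → ¬? (u Fin.≟ v) →-dec (col u v Fin.≟ col v u)

  majority? : ∀ c → Dec (IsMajority {n} {k} c)
  majority? c = all? λ u → all? λ α → 2 * degCol c u α ≤? _

  preserves? : ∀ (c : EdgeColouring n k) f → Dec (Preserves c f)
  preserves? c f = all? λ u → all? λ v → ¬? (u Fin.≟ v) →-dec (col c (f u) (f v) Fin.≟ col c u v)

  -- All maps are checked, not only bijections, so the otherwise unused diagonal of a colour
  -- table takes part in the check.
  Rigid : EdgeColouring n k → Set
  Rigid c = ∀ (images : Vec (Fin n) n) → Preserves c (lookup images) → ∀ u → lookup images u ≡ u

  rigid? : ∀ c → Dec (Rigid c)
  rigid? c = all-vectors? n λ images → preserves? c (lookup images) →-dec all? λ u → lookup images u Fin.≟ u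

  rigid⇒distinguishing : ∀ c → Rigid c → IsDistinguishing c
  rigid⇒distinguishing c rigid φ preserves u =
    trans (sym (lookup∘tabulate (φ ⟨$⟩ʳ_) u))
          (rigid (Vec.tabulate (φ ⟨$⟩ʳ_)) tabulated-preserves u)
    where
    tabulated-preserves : Preserves c (lookup (Vec.tabulate (φ ⟨$⟩ʳ_)))
    tabulated-preserves v w v≢w =
      trans (cong₂ (col c) (lookup∘tabulate _ v) (lookup∘tabulate _ w)) (preserves v w v≢w)

K₃-colouring : EdgeColouring 3 3
K₃-colouring = record { col = table ; sym = from-yes (symmetric? table) }
  where
  table : Fin 3 → Fin 3 → Fin 3
  table = fromTable ((0F ∷ 2F ∷ 1F ∷ []) ∷
                     (2F ∷ 0F ∷ 0F ∷ []) ∷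
                     (1F ∷ 0F ∷ 0F ∷ []) ∷ [])

K₃-MD : HasMDColouring 3 3
K₃-MD = K₃-colouring , from-yes (majority? K₃-colouring) , rigid⇒distinguishing K₃-colouring (from-yes (rigid? K₃-colouring))

K₄-colouring : EdgeColouring 4 5
K₄-colouring = record { col = table ; sym = from-yes (symmetric? table) }
  where
  table : Fin 4 → Fin 4 → Fin 5
  table = fromTable ((0F ∷ 0F ∷ 1F ∷ 3F ∷ []) ∷
                     (0F ∷ 0F ∷ 4F ∷ 2F ∷ []) ∷
                     (1F ∷ 4F ∷ 0F ∷ 0F ∷ []) ∷
                     (3F ∷ 2F ∷ 0F ∷ 0F ∷ []) ∷ [])

K₄-MD : HasMDColouring 4 5
K₄-MD = K₄-colouring , from-yes (majority? K₄-colouring) , rigid⇒distinguishing K₄-colouring (from-yes (rigid? K₄-colouring))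

two-members : ∀ {A : Set} {v w : A} {xs} → v ∈ xs → w ∈ xs → v ≢ w → 2 ≤ length xs
two-members (here refl) (here refl) v≢w = ⊥-elim (v≢w refl)
two-members (here _)    (there w∈)  _   = s≤s (∈-length w∈)
two-members (there v∈)  (here _)    _   = s≤s (∈-length v∈)
two-members (there v∈)  (there w∈)  v≢w = m≤n⇒m≤1+n (two-members v∈ w∈ v≢w)

lookup-injective : ∀ {A : Set} {xs : List A} → AllPairs _≢_ xs → ∀ {i j} → List.lookup xs i ≡ List.lookup xs j → i ≡ j
lookup-injective (_   ∷ _)        {Fin.zero}  {Fin.zero}  _ = refl
lookup-injective (x≢ ∷ _)        {Fin.zero}  {Fin.suc j} e = ⊥-elim (All.lookup x≢ (∈-lookup j) e)
lookup-injective (x≢ ∷ _)        {Fin.suc i} {Fin.zero}  e = ⊥-elim (All.lookup x≢ (∈-lookup i) (sym e))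
lookup-injective (_   ∷ distinct) {Fin.suc i} {Fin.suc j} e = cong Fin.suc (lookup-injective distinct e)

pairwise-distinct⇒length≤ : ∀ {k} {xs : List (Fin k)} → AllPairs _≢_ xs → length xs ≤ k
pairwise-distinct⇒length≤ distinct = injective⇒≤ (lookup-injective distinct)

module _ {n k : ℕ} where

  Proper : EdgeColouring n k → Set
  Proper c = ∀ u v w → u ≢ v → u ≢ w → v ≢ w → col c u v ≢ col c u w

  majority⇒proper : n ≤ 4 → ∀ c → IsMajority c → Proper c
  majority⇒proper n≤4 c majority u v w u≢v u≢w v≢w same =
    <-irrefl refl (≤-trans (*-monoʳ-≤ 2 two-edges) (≤-trans (majority u (col c u v)) (∸-monoˡ-≤ 1 n≤4)))
    where
    two-edges : 2 ≤ degCol c u (col c u v)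
    two-edges = two-members (∈-filter⁺ _ (∈-allFin v) (u≢v , refl)) (∈-filter⁺ _ (∈-allFin w) (u≢w , sym same)) v≢w

  relabel : Permutation′ n → EdgeColouring n k → EdgeColouring n k
  relabel ρ c = record
    { col = λ u v → col c (ρ ⟨$⟩ʳ u) (ρ ⟨$⟩ʳ v)
    ; sym = λ u v u≢v → col-sym c _ _ (u≢v ∘ permutation-injective ρ)
    }

  relabel-proper : ∀ ρ c → Proper c → Proper (relabel ρ c)
  relabel-proper ρ c proper u v w u≢v u≢w v≢w =
    proper _ _ _ (u≢v ∘ permutation-injective ρ) (u≢w ∘ permutation-injective ρ) (v≢w ∘ permutation-injective ρ)

  relabel-distinguishing : ∀ ρ c → IsDistinguishing c → IsDistinguishing (relabel ρ c)
  relabel-distinguishing ρ c distinguishing σ preserves u =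
    permutation-injective ρ (trans (cong (λ x → ρ ⟨$⟩ʳ (σ ⟨$⟩ʳ x)) (sym (inverseˡ ρ)))
                                   (distinguishing (flip ρ ∘ₚ σ ∘ₚ ρ) conjugate-preserves (ρ ⟨$⟩ʳ u)))
    where
    conjugate-preserves : Preserves c ((flip ρ ∘ₚ σ ∘ₚ ρ) ⟨$⟩ʳ_)
    conjugate-preserves x y x≢y =
      trans (preserves (ρ ⟨$⟩ˡ x) (ρ ⟨$⟩ˡ y) (x≢y ∘ permutation-injective (flip ρ)))
            (cong₂ (col c) (inverseʳ ρ) (inverseʳ ρ))

-- Relabelling by σ₂₃ or σ₁₃ moves the third matching {03, 12} to the place of the first or second.
σ₂₃ σ₁₃ : Permutation′ 4
σ₂₃ = transpose 2F 3F
σ₁₃ = transpose 1F 3F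

module _ {k : ℕ} (c : EdgeColouring 4 k) where

  two-monochromatic-matchings⇒¬distinguishing :
    col c 0F 1F ≡ col c 2F 3F → col c 0F 2F ≡ col c 1F 3F → ¬ IsDistinguishing c
  two-monochromatic-matchings⇒¬distinguishing m₁ m₂ distinguishing with distinguishing reverse preserves 0F
    where
    preserves : Preserves c (reverse ⟨$⟩ʳ_)
    preserves 0F 1F _ = trans (col-sym c 3F 2F (λ ())) (sym m₁)
    preserves 0F 2F _ = trans (col-sym c 3F 1F (λ ())) (sym m₂)
    preserves 0F 3F _ = col-sym c 3F 0F (λ ())
    preserves 1F 0F _ = trans (sym m₁) (col-sym c 0F 1F (λ ()))
    preserves 1F 2F _ = col-sym c 2F 1F (λ ())
    preserves 1F 3F _ = trans (col-sym c 2F 0F (λ ())) m₂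
    preserves 2F 0F _ = trans (sym m₂) (col-sym c 0F 2F (λ ()))
    preserves 2F 1F _ = col-sym c 1F 2F (λ ())
    preserves 2F 3F _ = trans (col-sym c 1F 0F (λ ())) m₁
    preserves 3F 0F _ = col-sym c 0F 3F (λ ())
    preserves 3F 1F _ = trans m₂ (col-sym c 1F 3F (λ ()))
    preserves 3F 2F _ = trans m₁ (col-sym c 2F 3F (λ ()))
    preserves 0F 0F u≢v = ⊥-elim (u≢v refl)
    preserves 1F 1F u≢v = ⊥-elim (u≢v refl)
    preserves 2F 2F u≢v = ⊥-elim (u≢v refl)
    preserves 3F 3F u≢v = ⊥-elim (u≢v refl)
  ... | ()  -- reverse ⟨$⟩ʳ 0F is 3F

  two-bichromatic-matchings⇒five-colours :
    Proper c → col c 0F 1F ≢ col c 2F 3F → col c 0F 2F ≢ col c 1F 3F → 5 ≤ k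
  two-bichromatic-matchings⇒five-colours proper d₁ d₂ =
    pairwise-distinct⇒length≤ {xs = col c 0F 1F ∷ col c 2F 3F ∷ col c 0F 2F ∷ col c 1F 3F ∷ col c 0F 3F ∷ []}
      ( (d₁ ∷ meet 0F 1F 2F (λ ()) (λ ()) (λ ()) refl refl
            ∷ meet 1F 0F 3F (λ ()) (λ ()) (λ ()) (col-sym c 1F 0F (λ ())) refl
            ∷ meet 0F 1F 3F (λ ()) (λ ()) (λ ()) refl refl ∷ [])
      ∷ (meet 2F 3F 0F (λ ()) (λ ()) (λ ()) refl (col-sym c 2F 0F (λ ()))
            ∷ meet 3F 2F 1F (λ ()) (λ ()) (λ ()) (col-sym c 3F 2F (λ ())) (col-sym c 3F 1F (λ ()))
            ∷ meet 3F 2F 0F (λ ()) (λ ()) (λ ()) (col-sym c 3F 2F (λ ())) (col-sym c 3F 0F (λ ())) ∷ [])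
      ∷ (d₂ ∷ meet 0F 2F 3F (λ ()) (λ ()) (λ ()) refl refl ∷ [])
      ∷ (meet 3F 1F 0F (λ ()) (λ ()) (λ ()) (col-sym c 3F 1F (λ ())) (col-sym c 3F 0F (λ ())) ∷ [])
      ∷ [] ∷ [])
    where
    meet : ∀ u v w {x y} → u ≢ v → u ≢ w → v ≢ w → col c u v ≡ x → col c u w ≡ y → x ≢ y
    meet u v w u≢v u≢w v≢w e₁ e₂ x≡y = proper u v w u≢v u≢w v≢w (trans e₁ (trans x≡y (sym e₂)))

proper-distinguishing-K₄⇒five : ∀ {k} (c : EdgeColouring 4 k) → Proper c → IsDistinguishing c → 5 ≤ k
proper-distinguishing-K₄⇒five c proper distinguishing
  with col c 0F 1F Fin.≟ col c 2F 3F | col c 0F 2F Fin.≟ col c 1F 3F | col c 0F 3F Fin.≟ col c 1F 2F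
... | yes m₁ | yes m₂ | _      = ⊥-elim (two-monochromatic-matchings⇒¬distinguishing c m₁ m₂ distinguishing)
... | no d₁  | no d₂  | _      = two-bichromatic-matchings⇒five-colours c proper d₁ d₂
... | yes m₁ | no _   | yes m₃ = ⊥-elim (two-monochromatic-matchings⇒¬distinguishing (relabel σ₂₃ c)
    (trans m₁ (col-sym c 2F 3F (λ ()))) m₃ (relabel-distinguishing σ₂₃ c distinguishing))
... | no d₁  | yes _  | no d₃  = two-bichromatic-matchings⇒five-colours (relabel σ₂₃ c) (relabel-proper σ₂₃ c proper)
    (λ e → d₁ (trans e (col-sym c 3F 2F (λ ())))) d₃
... | _      | yes m₂ | yes m₃ = ⊥-elim (two-monochromatic-matchings⇒¬distinguishing (relabel σ₁₃ c)
    (trans m₃ (col-sym c 1F 2F (λ ()))) (trans m₂ (col-sym c 1F 3F (λ ()))) (relabel-distinguishing σ₁₃ c distinguishing))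
... | _      | no d₂  | no d₃  = two-bichromatic-matchings⇒five-colours (relabel σ₁₃ c) (relabel-proper σ₁₃ c proper)
    (λ e → d₃ (trans e (col-sym c 2F 1F (λ ())))) (λ e → d₂ (trans e (col-sym c 3F 1F (λ ()))))

proposition12 :
    (∀ (n : ℕ) → 3 ≤ n → n ≢ 4 → M'D≤ n 3) × M'D≡ 4 5
proposition12 = three-colours-suffice , K₄-MD , fewer-than-five-fail
  where
  three-colours-suffice : ∀ n → 3 ≤ n → n ≢ 4 → M'D≤ n 3
  three-colours-suffice 1 (s≤s ())        _
  three-colours-suffice 2 (s≤s (s≤s ()))  _
  three-colours-suffice 3 _               _   = K₃-MD
  three-colours-suffice 4 _               4≢4 = ⊥-elim (4≢4 refl)
  three-colours-suffice (suc (suc (suc (suc (suc t))))) _ _ = pathColouring-MD t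
  fewer-than-five-fail : ∀ j → j < 5 → ¬ HasMDColouring 4 j
  fewer-than-five-fail j j<5 (c , majority , distinguishing) =
    <⇒≱ j<5 (proper-distinguishing-K₄⇒five c (majority⇒proper ≤-refl c majority) distinguishing)
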